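{- Let $a,k$ be integers with $2\leq a\leq k$. Then $t_k(n,K_{a,k})=(a-1)n^k(1+o(1))$ as $n\to\infty$. Furthermore, if $p\geq k$ is an integer, then $t_p(n,K_{2,k})=n^p(1+o(1))$ as $n\to\infty$.
   Context: All graphs are finite, simple, undirected. $K_{a,k}$ is the complete bipartite graph with classes of sizes $a$ and $k$. For a graph $G$ with degree sequence $d_1,\ldots,d_n$ and a positive integer $p$, $e_p(G)=\sum_{i=1}^n d_i^p$, and $t_p(n,H)$ is the maximum of $e_p(G)$ over all $n$-vertex graphs not containing $H$ as a subgraph. -}

module Defs where

open import Data.Nat using (ℕ; _+_; _*_; _^_; _≤_; _∸_; ∣_-_∣)
open import Data.Bool using (Bool; true; false; if_then_else_)
open import Data.Fin using (Fin)
open import Data.List using (List; map; allFin)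
open import Data.Nat.ListAction using (sum)
open import Data.Product using (Σ; _×_; ∃)
open import Function.Definitions using (Injective)
open import Relation.Binary.PropositionalEquality using (_≡_; _≢_)
open import Relation.Nullary using (¬_)

record Graph (n : ℕ) : Set where
  field
    adj   : Fin n → Fin n → Bool
    sym   : ∀ u v → adj u v ≡ adj v u
    irrefl : ∀ v → adj v v ≡ false
open Graph public

degree : ∀ {n} → Graph n → Fin n → ℕ
degree {n} G v = sum (map (λ w → if adj G v w then 1 else 0) (allFin n))

e : ℕ → ∀ {n} → Graph n → ℕ
e p {n} G = sum (map (λ v → degree G v ^ p) (allFin n))

ContainsK : ℕ → ℕ → ∀ {n} → Graph n → Set
ContainsK a k {n} G =
  Σ (Fin a → Fin n) λ f → Σ (Fin k → Fin n) λ g →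
    Injective _≡_ _≡_ f × Injective _≡_ _≡_ g ×
    (∀ i j → f i ≢ g j) × (∀ i j → adj G (f i) (g j) ≡ true)

IsT : ℕ → ℕ → ℕ → ℕ → ℕ → Set
IsT p a k n t =
  (Σ (Graph n) λ G → ¬ ContainsK a k G × e p G ≡ t) ×
  (∀ (G : Graph n) → ¬ ContainsK a k G → e p G ≤ t)

-- f(n) = g(n)(1 + o(1)) as n → ∞, for g eventually positive in our uses:
-- for every ε = 1/m (m ≥ 1) there is N with |f n - g n| ≤ g n / m for n ≥ N,
-- written without division as m * |f n - g n| ≤ g n.
AsympEq : (ℕ → ℕ) → (ℕ → ℕ) → Set
AsympEq f g = ∀ (m : ℕ) → 1 ≤ m → ∃ λ N → ∀ n → N ≤ n → m * ∣ f n - g n ∣ ≤ g n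

-- If G contains no K_{a,k}, every k-tuple of distinct vertices has at most a − 1 common
-- neighbours, so double counting the pairs (v, t) with t an injective k-tuple of
-- neighbours of v gives Σ_v (d_v − k)^k ≤ (a − 1) n^k. As d^k ≤ (1 + 1/M) (d − k)^k once
-- d ≥ (M + 1) k², and d^p ≤ n^(p−k) d^k, this bounds e_p(G) by (a − 1) n^p (1 + o(1)).
-- Conversely, for a ≤ k the complete bipartite graph K_{a−1, n−a+1} contains no K_{a,k},
-- and its a − 1 vertices on the small side alone give e_p ≥ (a − 1) (n − a + 1)^p.

module Submission where

open import Defs hiding (sym)
open import Data.Bool using (Bool; true; false; not; _∧_; _∨_; _xor_; T; if_then_else_)
open import Data.Bool.Properties using (∨-zeroʳ; ∧-conicalˡ; ∧-conicalʳ; not-injective; xor-comm; xor-same)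
open import Data.Empty using (⊥-elim)
open import Data.Fin using (Fin; zero; suc; toℕ; fromℕ<)
open import Data.Fin.Properties using (_≟_; suc-injective; injective⇒≤; toℕ-injective; toℕ-fromℕ<)
open import Data.List using (allFin; tabulate) renaming (map to mapᴸ)
import Data.List.Properties as List
import Data.Nat.ListAction as List
open import Data.Nat using (ℕ; zero; suc; _+_; _*_; _^_; _∸_; _≤_; _<_; _<ᵇ_; _⊔_; ∣_-_∣; z≤n; s≤s; s≤s⁻¹)
open import Data.Nat.Properties hiding (_≟_; suc-injective)
open import Data.Nat.Tactic.RingSolver using (solve-∀)
open import Data.Product using (Σ; ∃; _×_; _,_; proj₁; proj₂)
open import Data.Sum using (inj₁; inj₂)
open import Data.Vec.Functional using (Vector; []; _∷_; head; tail)
open import Function.Definitions using (Injective)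
open import Relation.Binary.PropositionalEquality
  using (_≡_; _≢_; refl; sym; trans; cong; cong₂; subst; module ≡-Reasoning)
open import Relation.Nullary using (¬_; does; yes; no)
open import Relation.Nullary.Decidable using (dec-true)
open import Algebra.Properties.Semiring.Sum +-*-semiring
  using (sum; sum-syntax; sum-cong-≗; sum-replicate-zero; ∑-comm; ∑-distrib-+; *-distribˡ-sum; *-distribʳ-sum)

𝟙 : Bool → ℕ
𝟙 b = if b then 1 else 0

𝟙≤1 : ∀ b → 𝟙 b ≤ 1
𝟙≤1 true  = ≤-refl
𝟙≤1 false = z≤n

𝟙-∧ : ∀ b c → 𝟙 (b ∧ c) ≡ 𝟙 b * 𝟙 c
𝟙-∧ true  c = sym (+-identityʳ (𝟙 c))
𝟙-∧ false c = refl

𝟙-∨ : ∀ b c → 𝟙 (b ∨ c) ≤ 𝟙 b + 𝟙 c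
𝟙-∨ true  c = s≤s z≤n
𝟙-∨ false c = ≤-refl

𝟙≤𝟙-∧-not+𝟙 : ∀ b c → 𝟙 b ≤ 𝟙 (b ∧ not c) + 𝟙 c
𝟙≤𝟙-∧-not+𝟙 true  true  = s≤s z≤n
𝟙≤𝟙-∧-not+𝟙 true  false = s≤s z≤n
𝟙≤𝟙-∧-not+𝟙 false c     = z≤n

sum-mono-≤ : ∀ {n} {f g : Fin n → ℕ} → (∀ i → f i ≤ g i) → sum f ≤ sum g
sum-mono-≤ {zero}  f≤g = z≤n
sum-mono-≤ {suc n} f≤g = +-mono-≤ (f≤g zero) (sum-mono-≤ (λ i → f≤g (suc i)))

sum-const : ∀ n c → ∑[ i < n ] c ≡ n * c
sum-const zero    c = refl
sum-const (suc n) c = cong (c +_) (sum-const n c)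

sum-map-allFin : ∀ {n} (f : Fin n → ℕ) → List.sum (mapᴸ f (allFin n)) ≡ sum f
sum-map-allFin {n} f = trans (cong List.sum (List.map-tabulate (λ i → i) f)) (sum-tabulate f)
  where
  sum-tabulate : ∀ {n} (f : Fin n → ℕ) → List.sum (tabulate f) ≡ sum f
  sum-tabulate {zero}  f = refl
  sum-tabulate {suc n} f = cong (f zero +_) (sum-tabulate (λ i → f (suc i)))

degree≡∑ : ∀ {n} (G : Graph n) v → degree G v ≡ ∑[ w < n ] 𝟙 (adj G v w)
degree≡∑ G v = sum-map-allFin (λ w → 𝟙 (adj G v w))

e≡∑ : ∀ p {n} (G : Graph n) → e p G ≡ ∑[ v < n ] (degree G v ^ p)
e≡∑ p G = sum-map-allFin (λ v → degree G v ^ p)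

degree≤n : ∀ {n} (G : Graph n) v → degree G v ≤ n
degree≤n {n} G v = begin
  degree G v               ≡⟨ degree≡∑ G v ⟩
  ∑[ w < n ] 𝟙 (adj G v w) ≤⟨ sum-mono-≤ (λ w → 𝟙≤1 (adj G v w)) ⟩
  ∑[ w < n ] 1             ≡⟨ sum-const n 1 ⟩
  n * 1                    ≡⟨ *-identityʳ n ⟩
  n                        ∎
  where open ≤-Reasoning

∑ᵗ : ∀ k {n} → (Vector (Fin n) k → ℕ) → ℕ
∑ᵗ zero        h = h []
∑ᵗ (suc k) {n} h = ∑[ x < n ] ∑ᵗ k (λ t → h (x ∷ t))

∑ᵗ-mono-≤ : ∀ k {n} {f g : Vector (Fin n) k → ℕ} → (∀ t → f t ≤ g t) → ∑ᵗ k f ≤ ∑ᵗ k g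
∑ᵗ-mono-≤ zero    f≤g = f≤g []
∑ᵗ-mono-≤ (suc k) f≤g = sum-mono-≤ (λ x → ∑ᵗ-mono-≤ k (λ t → f≤g (x ∷ t)))

*-distribˡ-∑ᵗ : ∀ k {n} c (f : Vector (Fin n) k → ℕ) → c * ∑ᵗ k f ≡ ∑ᵗ k (λ t → c * f t)
*-distribˡ-∑ᵗ zero    c f = refl
*-distribˡ-∑ᵗ (suc k) c f = trans (*-distribˡ-sum c (λ x → ∑ᵗ k (λ t → f (x ∷ t))))
  (sum-cong-≗ (λ x → *-distribˡ-∑ᵗ k c (λ t → f (x ∷ t))))

∑ᵗ-const : ∀ k {n} c → ∑ᵗ k {n} (λ _ → c) ≡ n ^ k * c
∑ᵗ-const zero        c = sym (*-identityˡ c)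
∑ᵗ-const (suc k) {n} c = begin
  ∑[ x < n ] ∑ᵗ k {n} (λ _ → c) ≡⟨ sum-cong-≗ {n} (λ _ → ∑ᵗ-const k {n} c) ⟩
  ∑[ x < n ] (n ^ k * c)        ≡⟨ sum-const n (n ^ k * c) ⟩
  n * (n ^ k * c)               ≡⟨ *-assoc n (n ^ k) c ⟨
  n ^ suc k * c                 ∎
  where open ≡-Reasoning

∑-∑ᵗ-comm : ∀ k {m n} (h : Fin m → Vector (Fin n) k → ℕ) →
            ∑[ v < m ] ∑ᵗ k (h v) ≡ ∑ᵗ k (λ t → ∑[ v < m ] h v t)
∑-∑ᵗ-comm zero    h = refl
∑-∑ᵗ-comm (suc k) h = trans (∑-comm (λ v x → ∑ᵗ k (λ t → h v (x ∷ t))))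
  (sum-cong-≗ (λ x → ∑-∑ᵗ-comm k (λ v t → h v (x ∷ t))))

_∈ᵇ_ : ∀ {n k} → Fin n → Vector (Fin n) k → Bool
_∈ᵇ_ {k = zero}  x t = false
_∈ᵇ_ {k = suc k} x t = does (x ≟ head t) ∨ x ∈ᵇ tail t

∈ᵇ-lookup : ∀ {n k} (t : Vector (Fin n) k) i → t i ∈ᵇ t ≡ true
∈ᵇ-lookup t zero    = cong (_∨ (t zero ∈ᵇ tail t)) (dec-true (t zero ≟ t zero) refl)
∈ᵇ-lookup t (suc i) = trans (cong (does (t (suc i) ≟ t zero) ∨_) (∈ᵇ-lookup (tail t) i)) (∨-zeroʳ _)

∈ᵇ≡false⇒≢ : ∀ {n k} {x : Fin n} (t : Vector (Fin n) k) → x ∈ᵇ t ≡ false → ∀ i → x ≢ t i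
∈ᵇ≡false⇒≢ t x∉t i refl with () ← trans (sym (∈ᵇ-lookup t i)) x∉t

∑-𝟙-≟ : ∀ {n} (y : Fin n) → ∑[ x < n ] 𝟙 (does (x ≟ y)) ≡ 1
∑-𝟙-≟ {suc n} zero    = cong suc (sum-replicate-zero n)
∑-𝟙-≟ {suc n} (suc y) = ∑-𝟙-≟ y

∑-𝟙-∈ᵇ≤ : ∀ {n k} (t : Vector (Fin n) k) → ∑[ x < n ] 𝟙 (x ∈ᵇ t) ≤ k
∑-𝟙-∈ᵇ≤ {n} {zero}  t = ≤-reflexive (sum-replicate-zero n)
∑-𝟙-∈ᵇ≤ {n} {suc k} t = begin
  ∑[ x < n ] 𝟙 (x ∈ᵇ t)                     ≤⟨ sum-mono-≤ (λ x → 𝟙-∨ (does (x ≟ head t)) (x ∈ᵇ tail t)) ⟩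
  ∑[ x < n ] (isHead x + inTail x)          ≡⟨ ∑-distrib-+ isHead inTail ⟩
  ∑[ x < n ] isHead x + ∑[ x < n ] inTail x ≤⟨ +-mono-≤ (≤-reflexive (∑-𝟙-≟ (head t))) (∑-𝟙-∈ᵇ≤ (tail t)) ⟩
  suc k                                     ∎
  where
  open ≤-Reasoning
  isHead inTail : Fin n → ℕ
  isHead x = 𝟙 (does (x ≟ head t))
  inTail x = 𝟙 (x ∈ᵇ tail t)

freshNeighbour : ∀ {n k} → Graph n → Fin n → Vector (Fin n) k → Fin n → Bool
freshNeighbour G v t x = adj G v x ∧ not (x ∈ᵇ t)

distinctNeighbours : ∀ {n k} → Graph n → Fin n → Vector (Fin n) k → Bool
distinctNeighbours {k = zero}  G v t = true
distinctNeighbours {k = suc k} G v t = freshNeighbour G v (tail t) (head t) ∧ distinctNeighbours G v (tail t)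

degree∸k≤∑-freshNeighbour : ∀ {n k} (G : Graph n) v (t : Vector (Fin n) k) →
                            degree G v ∸ k ≤ ∑[ x < n ] 𝟙 (freshNeighbour G v t x)
degree∸k≤∑-freshNeighbour {n} {k} G v t = m≤n+o⇒m∸n≤o (degree G v) k (begin
  degree G v                                      ≡⟨ degree≡∑ G v ⟩
  ∑[ x < n ] 𝟙 (adj G v x)                        ≤⟨ sum-mono-≤ (λ x → 𝟙≤𝟙-∧-not+𝟙 (adj G v x) (x ∈ᵇ t)) ⟩
  ∑[ x < n ] (𝟙 (fresh x) + 𝟙 (x ∈ᵇ t))           ≡⟨ ∑-distrib-+ (λ x → 𝟙 (fresh x)) (λ x → 𝟙 (x ∈ᵇ t)) ⟩
  ∑[ x < n ] 𝟙 (fresh x) + ∑[ x < n ] 𝟙 (x ∈ᵇ t) ≤⟨ +-monoʳ-≤ _ (∑-𝟙-∈ᵇ≤ t) ⟩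
  ∑[ x < n ] 𝟙 (fresh x) + k                      ≡⟨ +-comm _ k ⟩
  k + ∑[ x < n ] 𝟙 (fresh x)                      ∎)
  where
  open ≤-Reasoning
  fresh : Fin n → Bool
  fresh = freshNeighbour G v t

[degree∸k]^k≤∑ᵗ-distinctNeighbours : ∀ k {n} (G : Graph n) v →
  (degree G v ∸ k) ^ k ≤ ∑ᵗ k (λ t → 𝟙 (distinctNeighbours G v t))
[degree∸k]^k≤∑ᵗ-distinctNeighbours zero    G v = ≤-refl
[degree∸k]^k≤∑ᵗ-distinctNeighbours (suc j) {n} G v = begin
  (d ∸ suc j) ^ suc j                             ≤⟨ ^-monoˡ-≤ (suc j) (∸-monoʳ-≤ d (n≤1+n j)) ⟩
  (d ∸ j) * (d ∸ j) ^ j                           ≤⟨ *-monoʳ-≤ (d ∸ j) ([degree∸k]^k≤∑ᵗ-distinctNeighbours j G v) ⟩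
  (d ∸ j) * ∑ᵗ j (λ t → 𝟙 (dn t))                 ≡⟨ *-distribˡ-∑ᵗ j (d ∸ j) (λ t → 𝟙 (dn t)) ⟩
  ∑ᵗ j (λ t → (d ∸ j) * 𝟙 (dn t))                 ≤⟨ ∑ᵗ-mono-≤ j extend ⟩
  ∑ᵗ j (λ t → ∑[ x < n ] 𝟙 (dn (x ∷ t)))          ≡⟨ ∑-∑ᵗ-comm j (λ x t → 𝟙 (dn (x ∷ t))) ⟨
  ∑ᵗ (suc j) (λ t → 𝟙 (dn t))                     ∎
  where
  open ≤-Reasoning
  d : ℕ
  d = degree G v
  dn : ∀ {k} → Vector (Fin n) k → Bool
  dn = distinctNeighbours G v
  extend : ∀ t → (d ∸ j) * 𝟙 (dn t) ≤ ∑[ x < n ] 𝟙 (dn (x ∷ t))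
  extend t = begin
    (d ∸ j) * 𝟙 (dn t)                                      ≤⟨ *-monoˡ-≤ (𝟙 (dn t)) (degree∸k≤∑-freshNeighbour G v t) ⟩
    ∑[ x < n ] 𝟙 (freshNeighbour G v t x) * 𝟙 (dn t)        ≡⟨ *-distribʳ-sum (𝟙 (dn t)) (λ x → 𝟙 (freshNeighbour G v t x)) ⟩
    ∑[ x < n ] (𝟙 (freshNeighbour G v t x) * 𝟙 (dn t))      ≡⟨ sum-cong-≗ (λ x → 𝟙-∧ (freshNeighbour G v t x) (dn t)) ⟨
    ∑[ x < n ] 𝟙 (dn (x ∷ t))                               ∎

distinctNeighbours⇒adj : ∀ {n k} (G : Graph n) v (t : Vector (Fin n) k) →
                         distinctNeighbours G v t ≡ true → ∀ j → adj G v (t j) ≡ true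
distinctNeighbours⇒adj G v t dn zero    = ∧-conicalˡ _ _ (∧-conicalˡ _ _ dn)
distinctNeighbours⇒adj G v t dn (suc j) = distinctNeighbours⇒adj G v (tail t) (∧-conicalʳ _ _ dn) j

head∉tail : ∀ {n k} (G : Graph n) v (t : Vector (Fin n) (suc k)) →
            distinctNeighbours G v t ≡ true → head t ∈ᵇ tail t ≡ false
head∉tail G v t dn = not-injective (∧-conicalʳ (adj G v (head t)) _ (∧-conicalˡ _ (distinctNeighbours G v (tail t)) dn))

distinctNeighbours⇒injective : ∀ {n k} (G : Graph n) v (t : Vector (Fin n) k) →
                               distinctNeighbours G v t ≡ true → Injective _≡_ _≡_ t
distinctNeighbours⇒injective G v t dn {zero}  {zero}  _  = refl
distinctNeighbours⇒injective G v t dn {zero}  {suc j} eq = ⊥-elim (∈ᵇ≡false⇒≢ (tail t) (head∉tail G v t dn) j eq)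
distinctNeighbours⇒injective G v t dn {suc i} {zero}  eq = ⊥-elim (∈ᵇ≡false⇒≢ (tail t) (head∉tail G v t dn) i (sym eq))
distinctNeighbours⇒injective G v t dn {suc i} {suc j} eq =
  cong suc (distinctNeighbours⇒injective G v (tail t) (∧-conicalʳ _ _ dn) eq)

≤-∑𝟙⇒injection : ∀ {n a} (P : Fin n → Bool) → a ≤ ∑[ i < n ] 𝟙 (P i) →
                  Σ (Fin a → Fin n) λ f → Injective _≡_ _≡_ f × (∀ i → P (f i) ≡ true)
≤-∑𝟙⇒injection {a = zero}        P _  = (λ ()) , (λ { {()} }) , (λ ())
≤-∑𝟙⇒injection {zero} {suc a}    P ()
≤-∑𝟙⇒injection {suc n} {suc a}   P a≤∑ with P zero in P₀
... | false =
  let (f , f-inj , Pf) = ≤-∑𝟙⇒injection (λ i → P (suc i)) a≤∑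
  in (λ i → suc (f i)) , (λ eq → f-inj (suc-injective eq)) , Pf
... | true =
  let (f , f-inj , Pf) = ≤-∑𝟙⇒injection (λ i → P (suc i)) (s≤s⁻¹ a≤∑)
  in zero ∷ (λ i → suc (f i)) , ∷-injective f f-inj , λ { zero → P₀ ; (suc i) → Pf i }
  where
  ∷-injective : ∀ {m} (f : Fin m → Fin n) → Injective _≡_ _≡_ f → Injective _≡_ _≡_ (zero ∷ (λ i → suc (f i)))
  ∷-injective f f-inj {zero}  {zero}  _  = refl
  ∷-injective f f-inj {suc i} {suc j} eq = cong suc (f-inj (suc-injective eq))

∑-𝟙-distinctNeighbours≤ : ∀ {a k n} (G : Graph n) → ¬ ContainsK (suc a) k G →
                          ∀ t → ∑[ v < n ] 𝟙 (distinctNeighbours G v t) ≤ a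
∑-𝟙-distinctNeighbours≤ {a} {k} {n} G K-free t with ∑[ v < n ] 𝟙 (distinctNeighbours G v t) ≤? a
... | yes ∑≤a = ∑≤a
... | no  ∑≰a with ≤-∑𝟙⇒injection (λ v → distinctNeighbours G v t) (≰⇒> ∑≰a)
...   | f , f-inj , f-dn = ⊥-elim (K-free (f , t , f-inj , t-inj , f≢t , f~t))
  where
  t-inj : Injective _≡_ _≡_ t
  t-inj = distinctNeighbours⇒injective G (f zero) t (f-dn zero)
  f~t : ∀ i j → adj G (f i) (t j) ≡ true
  f~t i = distinctNeighbours⇒adj G (f i) t (f-dn i)
  f≢t : ∀ i j → f i ≢ t j
  f≢t i j eq with () ← trans (sym (f~t i j)) (trans (cong (λ u → adj G u (t j)) eq) (irrefl G (t j)))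

∑-[degree∸k]^k≤a*n^k : ∀ {a k n} (G : Graph n) → ¬ ContainsK (suc a) k G →
                       ∑[ v < n ] ((degree G v ∸ k) ^ k) ≤ a * n ^ k
∑-[degree∸k]^k≤a*n^k {a} {k} {n} G K-free = begin
  ∑[ v < n ] ((degree G v ∸ k) ^ k)             ≤⟨ sum-mono-≤ (λ v → [degree∸k]^k≤∑ᵗ-distinctNeighbours k G v) ⟩
  ∑[ v < n ] ∑ᵗ k (λ t → 𝟙 (dn v t))            ≡⟨ ∑-∑ᵗ-comm k (λ v t → 𝟙 (dn v t)) ⟩
  ∑ᵗ k (λ t → ∑[ v < n ] 𝟙 (dn v t))            ≤⟨ ∑ᵗ-mono-≤ k (∑-𝟙-distinctNeighbours≤ G K-free) ⟩
  ∑ᵗ k {n} (λ _ → a)                            ≡⟨ ∑ᵗ-const k a ⟩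
  n ^ k * a                                     ≡⟨ *-comm (n ^ k) a ⟩
  a * n ^ k                                     ∎
  where
  open ≤-Reasoning
  dn : Fin n → Vector (Fin n) k → Bool
  dn = distinctNeighbours G

x^[1+j]≤[x∸y]^[1+j]+[1+j]*y*x^j : ∀ j x y → x ^ suc j ≤ (x ∸ y) ^ suc j + suc j * y * x ^ j
x^[1+j]≤[x∸y]^[1+j]+[1+j]*y*x^j zero x y = begin
  x * 1                     ≡⟨ *-identityʳ x ⟩
  x                         ≤⟨ m≤n+m∸n x y ⟩
  y + (x ∸ y)               ≡⟨ shuffle y (x ∸ y) ⟩
  (x ∸ y) * 1 + 1 * y * 1   ∎
  where
  open ≤-Reasoning
  shuffle : ∀ a b → a + b ≡ b * 1 + 1 * a * 1
  shuffle = solve-∀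
x^[1+j]≤[x∸y]^[1+j]+[1+j]*y*x^j (suc j) x y = begin
  x * x ^ suc j                                   ≤⟨ *-monoʳ-≤ x (x^[1+j]≤[x∸y]^[1+j]+[1+j]*y*x^j j x y) ⟩
  x * (z ^ suc j + suc j * y * x ^ j)             ≡⟨ expand₁ x (z ^ suc j) (suc j) y (x ^ j) ⟩
  x * z ^ suc j + suc j * y * x ^ suc j           ≤⟨ +-monoˡ-≤ _ (*-monoˡ-≤ (z ^ suc j) (m≤n+m∸n x y)) ⟩
  (y + z) * z ^ suc j + suc j * y * x ^ suc j     ≡⟨ expand₂ y z (z ^ suc j) (suc j) (x ^ suc j) ⟩
  z ^ suc (suc j) + y * z ^ suc j + suc j * y * x ^ suc j
      ≤⟨ +-monoˡ-≤ (suc j * y * x ^ suc j) (+-monoʳ-≤ (z ^ suc (suc j)) (*-monoʳ-≤ y (^-monoˡ-≤ (suc j) (m∸n≤m x y)))) ⟩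
  z ^ suc (suc j) + y * x ^ suc j + suc j * y * x ^ suc j
      ≡⟨ collect (z ^ suc (suc j)) y (x ^ suc j) j ⟩
  z ^ suc (suc j) + suc (suc j) * y * x ^ suc j   ∎
  where
  open ≤-Reasoning
  z : ℕ
  z = x ∸ y
  expand₁ : ∀ x P s y X → x * (P + s * y * X) ≡ x * P + s * y * (x * X)
  expand₁ = solve-∀
  expand₂ : ∀ y z P s Q → (y + z) * P + s * y * Q ≡ z * P + y * P + s * y * Q
  expand₂ = solve-∀
  collect : ∀ A y X j → A + y * X + suc j * y * X ≡ A + suc (suc j) * y * X
  collect = solve-∀

M*d^k≤[1+M]*[d∸k]^k : ∀ M k {d} → suc M * k * k ≤ d → M * d ^ k ≤ suc M * (d ∸ k) ^ k
M*d^k≤[1+M]*[d∸k]^k M zero    _    = *-monoˡ-≤ 1 (n≤1+n M)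
M*d^k≤[1+M]*[d∸k]^k M (suc j) {d} D≤d = +-cancelˡ-≤ (d ^ k) _ _ (begin
  suc M * d ^ k                        ≤⟨ *-monoʳ-≤ (suc M) (x^[1+j]≤[x∸y]^[1+j]+[1+j]*y*x^j j d k) ⟩
  suc M * ((d ∸ k) ^ k + k * k * d ^ j) ≡⟨ expand (suc M) ((d ∸ k) ^ k) k (d ^ j) ⟩
  suc M * (d ∸ k) ^ k + suc M * k * k * d ^ j ≤⟨ +-monoʳ-≤ _ (*-monoˡ-≤ (d ^ j) D≤d) ⟩
  suc M * (d ∸ k) ^ k + d ^ k          ≡⟨ +-comm _ (d ^ k) ⟩
  d ^ k + suc M * (d ∸ k) ^ k          ∎)
  where
  open ≤-Reasoning
  k : ℕ
  k = suc j
  expand : ∀ A X k Y → A * (X + k * k * Y) ≡ A * X + A * k * k * Y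
  expand = solve-∀

M*d^k≤[1+M]*[d∸k]^k+M*D^k : ∀ M k d → M * d ^ k ≤ suc M * (d ∸ k) ^ k + M * (suc M * k * k) ^ k
M*d^k≤[1+M]*[d∸k]^k+M*D^k M k d with ≤-total d (suc M * k * k)
... | inj₁ d≤D = ≤-trans (*-monoʳ-≤ M (^-monoˡ-≤ k d≤D)) (m≤n+m _ _)
... | inj₂ D≤d = ≤-trans (M*d^k≤[1+M]*[d∸k]^k M k D≤d) (m≤m+n _ _)

m^[p∸k]*m^k≡m^p : ∀ m {k p} → k ≤ p → m ^ (p ∸ k) * m ^ k ≡ m ^ p
m^[p∸k]*m^k≡m^p m {k} {p} k≤p = trans (sym (^-distribˡ-+-* m (p ∸ k) k)) (cong (m ^_) (m∸n+n≡m k≤p))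

m^p≤n^[p∸k]*m^k : ∀ {m n k p} → m ≤ n → k ≤ p → m ^ p ≤ n ^ (p ∸ k) * m ^ k
m^p≤n^[p∸k]*m^k {m} {n} {k} {p} m≤n k≤p = begin
  m ^ p                 ≡⟨ m^[p∸k]*m^k≡m^p m k≤p ⟨
  m ^ (p ∸ k) * m ^ k   ≤⟨ *-monoˡ-≤ (m ^ k) (^-monoˡ-≤ (p ∸ k) m≤n) ⟩
  n ^ (p ∸ k) * m ^ k   ∎
  where open ≤-Reasoning

M*e≤[1+M]*a*n^p+error : ∀ {a k n} p (G : Graph n) → ¬ ContainsK (suc a) k G → k ≤ p → ∀ M →
  M * e p G ≤ suc M * (a * n ^ p) + n ^ (p ∸ k) * n * (M * (suc M * k * k) ^ k)
M*e≤[1+M]*a*n^p+error {a} {k} {n} p G K-free k≤p M = begin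
  M * e p G                                   ≡⟨ cong (M *_) (e≡∑ p G) ⟩
  M * ∑[ v < n ] (d v ^ p)                    ≡⟨ *-distribˡ-sum M (λ v → d v ^ p) ⟩
  ∑[ v < n ] (M * d v ^ p)                    ≤⟨ sum-mono-≤ vertex-bound ⟩
  ∑[ v < n ] (Q * (S * x v + E))              ≡⟨ *-distribˡ-sum Q (λ v → S * x v + E) ⟨
  Q * ∑[ v < n ] (S * x v + E)                ≡⟨ cong (Q *_) (∑-distrib-+ (λ v → S * x v) (λ _ → E)) ⟩
  Q * (∑[ v < n ] (S * x v) + ∑[ v < n ] E)   ≡⟨ cong₂ (λ A B → Q * (A + B)) (*-distribˡ-sum S x) (sym (sum-const n E)) ⟨
  Q * (S * ∑[ v < n ] x v + n * E)            ≤⟨ *-monoʳ-≤ Q (+-monoˡ-≤ (n * E) (*-monoʳ-≤ S (∑-[degree∸k]^k≤a*n^k G K-free))) ⟩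
  Q * (S * (a * n ^ k) + n * E)               ≡⟨ rearrange Q S a (n ^ k) n E ⟩
  S * (a * (Q * n ^ k)) + Q * n * E           ≡⟨ cong (λ P → S * (a * P) + Q * n * E) (m^[p∸k]*m^k≡m^p n k≤p) ⟩
  S * (a * n ^ p) + Q * n * E                 ∎
  where
  open ≤-Reasoning
  d : Fin n → ℕ
  d = degree G
  x : Fin n → ℕ
  x v = (d v ∸ k) ^ k
  S Q E : ℕ
  S = suc M
  Q = n ^ (p ∸ k)
  E = M * (suc M * k * k) ^ k
  rearrange : ∀ Q S a N n E → Q * (S * (a * N) + n * E) ≡ S * (a * (Q * N)) + Q * n * E
  rearrange = solve-∀
  vertex-bound : ∀ v → M * d v ^ p ≤ Q * (S * x v + E)
  vertex-bound v = begin
    M * d v ^ p             ≤⟨ *-monoʳ-≤ M (m^p≤n^[p∸k]*m^k (degree≤n G v) k≤p) ⟩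
    M * (Q * d v ^ k)       ≡⟨ *-comm-middle M Q (d v ^ k) ⟩
    Q * (M * d v ^ k)       ≤⟨ *-monoʳ-≤ Q (M*d^k≤[1+M]*[d∸k]^k+M*D^k M k (d v)) ⟩
    Q * (S * x v + E)       ∎
    where
    *-comm-middle : ∀ a b c → a * (b * c) ≡ b * (a * c)
    *-comm-middle = solve-∀

isSmall : ∀ {n} → ℕ → Fin n → Bool
isSmall c v = toℕ v <ᵇ c

completeBipartite : ∀ c n → Graph n
completeBipartite c n = record
  { adj    = λ u v → isSmall c u xor isSmall c v
  ; sym    = λ u v → xor-comm (isSmall c u) (isSmall c v)
  ; irrefl = λ v → xor-same (isSmall c v)
  }

∑-𝟙-isSmall : ∀ {n c} → c ≤ n → ∑[ v < n ] 𝟙 (isSmall c v) ≡ c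
∑-𝟙-isSmall {n}     {zero}  _         = sum-replicate-zero n
∑-𝟙-isSmall {suc n} {suc c} (s≤s c≤n) = cong suc (∑-𝟙-isSmall c≤n)

∑-𝟙-not-isSmall : ∀ n c → ∑[ v < n ] 𝟙 (not (isSmall c v)) ≡ n ∸ c
∑-𝟙-not-isSmall zero    zero    = refl
∑-𝟙-not-isSmall zero    (suc c) = refl
∑-𝟙-not-isSmall (suc n) zero    = trans (sum-const (suc n) 1) (*-identityʳ (suc n))
∑-𝟙-not-isSmall (suc n) (suc c) = ∑-𝟙-not-isSmall n c

degree-isSmall : ∀ {c n} v → isSmall c v ≡ true → degree (completeBipartite c n) v ≡ n ∸ c
degree-isSmall {c} {n} v small = begin
  degree (completeBipartite c n) v                  ≡⟨ degree≡∑ (completeBipartite c n) v ⟩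
  ∑[ w < n ] 𝟙 (isSmall c v xor isSmall c w)        ≡⟨ sum-cong-≗ {n} (λ w → cong (λ b → 𝟙 (b xor isSmall c w)) small) ⟩
  ∑[ w < n ] 𝟙 (not (isSmall c w))                  ≡⟨ ∑-𝟙-not-isSmall n c ⟩
  n ∸ c                                             ∎
  where open ≡-Reasoning

c*[n∸c]^p≤e : ∀ {c n} p → c ≤ n → c * (n ∸ c) ^ p ≤ e p (completeBipartite c n)
c*[n∸c]^p≤e {c} {n} p c≤n = begin
  c * X                                     ≡⟨ cong (_* X) (∑-𝟙-isSmall {n} c≤n) ⟨
  ∑[ v < n ] 𝟙 (isSmall c v) * X            ≡⟨ *-distribʳ-sum {n} X (λ v → 𝟙 (isSmall c v)) ⟩
  ∑[ v < n ] (𝟙 (isSmall c v) * X)          ≤⟨ sum-mono-≤ small-vertex ⟩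
  ∑[ v < n ] (degree G v ^ p)               ≡⟨ e≡∑ p G ⟨
  e p G                                     ∎
  where
  open ≤-Reasoning
  G : Graph n
  G = completeBipartite c n
  X : ℕ
  X = (n ∸ c) ^ p
  small-vertex : ∀ v → 𝟙 (isSmall c v) * X ≤ degree G v ^ p
  small-vertex v with isSmall c v | degree-isSmall {c} {n} v
  ... | true  | degree≡n∸c = ≤-reflexive (trans (+-identityʳ X) (cong (_^ p) (sym (degree≡n∸c refl))))
  ... | false | _          = z≤n

injective-isSmall⇒≤ : ∀ {m n c} (u : Fin m → Fin n) → Injective _≡_ _≡_ u →
                      (∀ i → isSmall c (u i) ≡ true) → m ≤ c
injective-isSmall⇒≤ {m} {c = c} u u-inj small = injective⇒≤ {f = u′} u′-inj
  where
  u<c : ∀ i → toℕ (u i) < c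
  u<c i = <ᵇ⇒< (toℕ (u i)) c (subst T (sym (small i)) _)
  u′ : Fin m → Fin c
  u′ i = fromℕ< (u<c i)
  u′-inj : Injective _≡_ _≡_ u′
  u′-inj {i} {j} eq = u-inj (toℕ-injective (begin
    toℕ (u i)       ≡⟨ toℕ-fromℕ< (u<c i) ⟨
    toℕ (u′ i)      ≡⟨ cong toℕ eq ⟩
    toℕ (u′ j)      ≡⟨ toℕ-fromℕ< (u<c j) ⟩
    toℕ (u j)       ∎))
    where open ≡-Reasoning

xor≡true⇒≡not : ∀ x y → x xor y ≡ true → x ≡ not y
xor≡true⇒≡not true  y eq = sym eq
xor≡true⇒≡not false y eq = cong not (sym eq)

-- Whichever part contains g zero, one side of the K_{c+1,k} lies among the c small vertices.
completeBipartite-free : ∀ {c k n} → suc c ≤ k → ¬ ContainsK (suc c) k (completeBipartite c n)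
completeBipartite-free {c} {suc k} (s≤s c≤k) (f , g , f-inj , g-inj , _ , f~g)
  with isSmall c (g zero) in g₀-small
... | false = 1+n≰n (injective-isSmall⇒≤ f f-inj f-small)
  where
  f-small : ∀ i → isSmall c (f i) ≡ true
  f-small i = trans (xor≡true⇒≡not _ _ (f~g i zero)) (cong not g₀-small)
... | true  = 1+n≰n (≤-trans (s≤s c≤k) (injective-isSmall⇒≤ g g-inj g-small))
  where
  f₀-large : isSmall c (f zero) ≡ false
  f₀-large = trans (xor≡true⇒≡not _ _ (f~g zero zero)) (cong not g₀-small)
  g-small : ∀ j → isSmall c (g j) ≡ true
  g-small j = not-injective (trans (sym (xor≡true⇒≡not _ _ (f~g zero j))) f₀-large)

Eventually : (ℕ → Set) → Set
Eventually P = ∃ λ N → ∀ n → N ≤ n → P n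

eventually-× : ∀ {P Q : ℕ → Set} → Eventually P → Eventually Q → Eventually (λ n → P n × Q n)
eventually-× (N₁ , p) (N₂ , q) =
  N₁ ⊔ N₂ , λ n N≤n → p n (≤-trans (m≤m⊔n N₁ N₂) N≤n) , q n (≤-trans (m≤n⊔m N₁ N₂) N≤n)

AsympEq-congʳ : ∀ {f g h} → (∀ n → g n ≡ h n) → AsympEq f g → AsympEq f h
AsympEq-congʳ {f} g≡h f~g m 1≤m =
  let (N , close) = f~g m 1≤m
  in N , λ n N≤n → subst (λ y → m * ∣ f n - y ∣ ≤ y) (g≡h n) (close n N≤n)

m*[x∸y]≤z : ∀ m x y z → m * x ≤ z + m * y → m * (x ∸ y) ≤ z
m*[x∸y]≤z m x y z h = begin
  m * (x ∸ y)     ≡⟨ *-distribˡ-∸ m x y ⟩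
  m * x ∸ m * y   ≤⟨ m≤n+o⇒m∸n≤o (m * x) (m * y) (≤-trans h (≤-reflexive (+-comm z (m * y)))) ⟩
  z               ∎
  where open ≤-Reasoning

m*∣x-y∣≤y : ∀ m x y → m * x ≤ y + m * y → m * y ≤ y + m * x → m * ∣ x - y ∣ ≤ y
m*∣x-y∣≤y m x y upper lower with ≤-total x y
... | inj₁ x≤y = subst (λ d → m * d ≤ y) (sym (m≤n⇒∣m-n∣≡n∸m x≤y)) (m*[x∸y]≤z m y x y lower)
... | inj₂ y≤x = subst (λ d → m * d ≤ y) (sym (trans (∣-∣-comm x y) (m≤n⇒∣m-n∣≡n∸m y≤x))) (m*[x∸y]≤z m x y y upper)

n*n≤n^k : ∀ n {k} → 2 ≤ k → n * n ≤ n ^ k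
n*n≤n^k zero    (s≤s (s≤s _)) = z≤n
n*n≤n^k (suc n) 2≤k = ≤-trans (≤-reflexive (cong (suc n *_) (sym (*-identityʳ (suc n))))) (^-monoʳ-≤ (suc n) 2≤k)

n^[p∸k]*n*x≤c*n^p : ∀ {n x c k p} → x ≤ n → 1 ≤ c → 2 ≤ k → k ≤ p → n ^ (p ∸ k) * n * x ≤ c * n ^ p
n^[p∸k]*n*x≤c*n^p {n} {x} {c} {k} {p} x≤n 1≤c 2≤k k≤p = begin
  n ^ (p ∸ k) * n * x     ≤⟨ *-monoʳ-≤ (n ^ (p ∸ k) * n) x≤n ⟩
  n ^ (p ∸ k) * n * n     ≡⟨ *-assoc (n ^ (p ∸ k)) n n ⟩
  n ^ (p ∸ k) * (n * n)   ≤⟨ *-monoʳ-≤ (n ^ (p ∸ k)) (n*n≤n^k n 2≤k) ⟩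
  n ^ (p ∸ k) * n ^ k     ≡⟨ m^[p∸k]*m^k≡m^p n k≤p ⟩
  n ^ p                   ≡⟨ *-identityˡ (n ^ p) ⟨
  1 * n ^ p               ≤⟨ *-monoˡ-≤ (n ^ p) 1≤c ⟩
  c * n ^ p               ∎
  where open ≤-Reasoning

m*[c*n^p]≤c*n^p+m*t : ∀ m {c n t} p → c * (n ∸ c) ^ p ≤ t → m * c * p ≤ n → m * (c * n ^ p) ≤ c * n ^ p + m * t
m*[c*n^p]≤c*n^p+m*t m zero    lower _ = ≤-trans (*-monoʳ-≤ m lower) (m≤n+m _ _)
m*[c*n^p]≤c*n^p+m*t m {c} {n} {t} (suc j) lower mcp≤n = begin
  m * (c * n ^ p)                                  ≤⟨ *-monoʳ-≤ m (*-monoʳ-≤ c (x^[1+j]≤[x∸y]^[1+j]+[1+j]*y*x^j j n c)) ⟩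
  m * (c * ((n ∸ c) ^ p + p * c * n ^ j))          ≡⟨ expand m c ((n ∸ c) ^ p) p (n ^ j) ⟩
  m * (c * (n ∸ c) ^ p) + c * (m * c * p * n ^ j)  ≤⟨ +-mono-≤ (*-monoʳ-≤ m lower) (*-monoʳ-≤ c (*-monoˡ-≤ (n ^ j) mcp≤n)) ⟩
  m * t + c * n ^ p                                ≡⟨ +-comm (m * t) (c * n ^ p) ⟩
  c * n ^ p + m * t                                ∎
  where
  open ≤-Reasoning
  p : ℕ
  p = suc j
  expand : ∀ m c X p Y → m * (c * (X + p * c * Y)) ≡ m * (c * X) + c * (m * c * p * Y)
  expand = solve-∀

-- Using the vertex estimate with M = 2m leaves half of the admissible error c n^p / m
-- to absorb the vertices of degree below (M + 1) k².
upper-eventually : ∀ {c k p} {T : ℕ → ℕ} → 1 ≤ c → 2 ≤ k → k ≤ p → (∀ n → IsT p (suc c) k n (T n)) →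
                   ∀ m → Eventually (λ n → m * T n ≤ c * n ^ p + m * (c * n ^ p))
upper-eventually {c} {k} {p} {T} 1≤c 2≤k k≤p isT m = E , bound
  where
  M E : ℕ
  M = m + m
  E = M * (suc M * k * k) ^ k
  double : ∀ m t → 2 * (m * t) ≡ (m + m) * t
  double = solve-∀
  halve : ∀ m g → suc (m + m) * g + g ≡ 2 * (g + m * g)
  halve = solve-∀
  bound : ∀ n → E ≤ n → m * T n ≤ c * n ^ p + m * (c * n ^ p)
  bound n E≤n with proj₁ (isT n)
  ... | G , K-free , e≡T = *-cancelˡ-≤ 2 (begin
    2 * (m * T n)                       ≡⟨ double m (T n) ⟩
    M * T n                             ≡⟨ cong (M *_) e≡T ⟨
    M * e p G                           ≤⟨ M*e≤[1+M]*a*n^p+error p G K-free k≤p M ⟩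
    suc M * g + n ^ (p ∸ k) * n * E     ≤⟨ +-monoʳ-≤ (suc M * g) (n^[p∸k]*n*x≤c*n^p E≤n 1≤c 2≤k k≤p) ⟩
    suc M * g + g                       ≡⟨ halve m g ⟩
    2 * (g + m * g)                     ∎)
    where
    open ≤-Reasoning
    g : ℕ
    g = c * n ^ p

lower-eventually : ∀ {c k p} {T : ℕ → ℕ} → suc c ≤ k → (∀ n → IsT p (suc c) k n (T n)) →
                   ∀ m → Eventually (λ n → m * (c * n ^ p) ≤ c * n ^ p + m * T n)
lower-eventually {c} {k} {p} {T} c<k isT m = c + m * c * p , λ n N≤n →
  m*[c*n^p]≤c*n^p+m*t m p (T-lower n (≤-trans (m≤m+n c _) N≤n)) (≤-trans (m≤n+m _ c) N≤n)
  where
  T-lower : ∀ n → c ≤ n → c * (n ∸ c) ^ p ≤ T n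
  T-lower n c≤n = ≤-trans (c*[n∸c]^p≤e p c≤n)
    (proj₂ (isT n) (completeBipartite c n) (completeBipartite-free c<k))

asymptotic : ∀ a k p → 2 ≤ a → a ≤ k → k ≤ p → (T : ℕ → ℕ) → (∀ n → IsT p a k n (T n)) →
             AsympEq T (λ n → (a ∸ 1) * n ^ p)
asymptotic (suc c) k p (s≤s 1≤c) a≤k k≤p T isT m _ =
  let (N , bounds) = eventually-× (upper-eventually 1≤c (≤-trans (s≤s 1≤c) a≤k) k≤p isT m)
                                  (lower-eventually {p = p} a≤k isT m)
  in N , λ n N≤n → let (upper , lower) = bounds n N≤n in m*∣x-y∣≤y m (T n) (c * n ^ p) upper lower

proposition5p1 :
    (∀ (a k : ℕ) → 2 ≤ a → a ≤ k → (T : ℕ → ℕ) → (∀ n → IsT k a k n (T n)) →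
      AsympEq T (λ n → (a ∸ 1) * n ^ k))
    × (∀ (k p : ℕ) → 2 ≤ k → k ≤ p → (T : ℕ → ℕ) → (∀ n → IsT p 2 k n (T n)) →
      AsympEq T (λ n → n ^ p))
proposition5p1 =
    (λ a k 2≤a a≤k → asymptotic a k k 2≤a a≤k ≤-refl)
  , (λ k p 2≤k k≤p T isT → AsympEq-congʳ {T} (λ n → *-identityˡ (n ^ p)) (asymptotic 2 k p ≤-refl 2≤k k≤p T isT))
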